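{- (1) Let $e,f,h$ be idempotents of $M_2(\mathbb{C})$ of rank one and $\lambda\in\mathbb{C}$ with $ef=\lambda h$. If $\pi(e)=([a:b],[c:d])$, $\pi(f)=([x:y],[z:w])$ and $\pi(h)=([a:b],[z:w])$, then \[\lambda=\frac{(aw-bz)(dx-cy)}{(ad-bc)(xw-yz)}.\] (2) Given pairwise distinct $[a:b],[x:y],[z:w]\in\mathbb{C}P^1$, the map \[[c:d]\mapsto \frac{(aw-bz)(dx-cy)}{(ad-bc)(xw-yz)}\] from $\mathbb{C}P^1\setminus\{[a:b],[x:y]\}$ to $\mathbb{C}^\times$ is a bijection.
   Context: $\pi:M_2(\mathbb{C})\to M_2(\mathbb{C})/\mathbb{C}^\times$ is the quotient map. For a rank-one matrix $A$, $\pi(A)$ is written as the pair $(v,u)\in(\mathbb{C}P^1)^2$ where $v$ is the image (column space) of $A$ and $u$ is its kernel; so $\pi(e)=([a:b],[c:d])$ means $e$ has image spanned by $(a,b)^T$ and kernel spanned by $(c,d)^T$. The value of the expression does not depend on the choice of homogeneous coordinates. -}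

module Defs where

open import Level using (Level; _⊔_)
open import Data.Nat using (ℕ; zero; suc)
open import Data.List using (List; []; _∷_)
open import Data.Product using (Σ; ∃; _×_; _,_)
open import Relation.Nullary using (¬_)
open import Algebra.Bundles using (CommutativeRing)

module _ {c ℓ : Level} (R : CommutativeRing c ℓ) where
  open CommutativeRing R renaming (Carrier to K)

  record IsField : Set (c ⊔ ℓ) where
    field
      1≉0   : ¬ (1# ≈ 0#)
      inv   : (x : K) → ¬ (x ≈ 0#) → K
      inv-r : (x : K) (p : ¬ (x ≈ 0#)) → x * inv x p ≈ 1#

  n·1 : ℕ → K
  n·1 zero    = 0#
  n·1 (suc n) = 1# + n·1 n

  hornerFrom : K → List K → K → K
  hornerFrom acc []       x = acc
  hornerFrom acc (a ∷ as) x = hornerFrom (acc * x + a) as x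

  -- the axioms singling out fields like ℂ: algebraically closed of characteristic 0
  record IsAlgClosedChar0Field : Set (c ⊔ ℓ) where
    field
      isField   : IsField
      char0     : (n : ℕ) → ¬ (n·1 (suc n) ≈ 0#)
      -- every monic polynomial x^(n+1) + a₀ xⁿ + … + aₙ of degree ≥ 1 has a root
      algClosed : (a : K) (as : List K) → ∃ λ x → hornerFrom 1# (a ∷ as) x ≈ 0#

  record V2 : Set c where
    constructor vec
    field
      v₁ v₂ : K

  record M2 : Set c where
    constructor mat
    field
      m₁₁ m₁₂ m₂₁ m₂₂ : K

  open V2
  open M2

  _≈V_ : V2 → V2 → Set ℓ
  u ≈V v = (v₁ u ≈ v₁ v) × (v₂ u ≈ v₂ v)

  _≈M_ : M2 → M2 → Set ℓ
  A ≈M B = (m₁₁ A ≈ m₁₁ B) × (m₁₂ A ≈ m₁₂ B) × (m₂₁ A ≈ m₂₁ B) × (m₂₂ A ≈ m₂₂ B)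

  0V : V2
  0V = vec 0# 0#

  0M : M2
  0M = mat 0# 0# 0# 0#

  _·V_ : K → V2 → V2
  t ·V v = vec (t * v₁ v) (t * v₂ v)

  _·M_ : K → M2 → M2
  t ·M A = mat (t * m₁₁ A) (t * m₁₂ A) (t * m₂₁ A) (t * m₂₂ A)

  _*M_ : M2 → M2 → M2
  A *M B = mat (m₁₁ A * m₁₁ B + m₁₂ A * m₂₁ B) (m₁₁ A * m₁₂ B + m₁₂ A * m₂₂ B)
               (m₂₁ A * m₁₁ B + m₂₂ A * m₂₁ B) (m₂₁ A * m₁₂ B + m₂₂ A * m₂₂ B)

  _*MV_ : M2 → V2 → V2
  A *MV v = vec (m₁₁ A * v₁ v + m₁₂ A * v₂ v) (m₂₁ A * v₁ v + m₂₂ A * v₂ v)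

  det : M2 → K
  det A = m₁₁ A * m₂₂ A - m₁₂ A * m₂₁ A

  IsIdempotent : M2 → Set ℓ
  IsIdempotent A = (A *M A) ≈M A

  IsRankOne : M2 → Set ℓ
  IsRankOne A = (¬ (A ≈M 0M)) × (det A ≈ 0#)

  NonzeroV : V2 → Set ℓ
  NonzeroV v = ¬ (v ≈V 0V)

  InImage : M2 → V2 → Set (c ⊔ ℓ)
  InImage A w = ∃ λ u → (A *MV u) ≈V w

  InKernel : M2 → V2 → Set ℓ
  InKernel A w = (A *MV w) ≈V 0V

  InSpan : V2 → V2 → Set (c ⊔ ℓ)
  InSpan v w = ∃ λ t → w ≈V (t ·V v)

  ImageSpannedBy : M2 → V2 → Set (c ⊔ ℓ)
  ImageSpannedBy A v = NonzeroV v × (∀ w → InImage A w → InSpan v w) × (∀ w → InSpan v w → InImage A w)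

  KernelSpannedBy : M2 → V2 → Set (c ⊔ ℓ)
  KernelSpannedBy A v = NonzeroV v × (∀ w → InKernel A w → InSpan v w) × (∀ w → InSpan v w → InKernel A w)

  πIs : M2 → V2 → V2 → Set (c ⊔ ℓ)
  πIs A v u = ImageSpannedBy A v × KernelSpannedBy A u

  -- P¹: nonzero vectors up to nonzero scalars
  record P1pt : Set (c ⊔ ℓ) where
    constructor pt
    field
      vecOf   : V2
      nonzero : NonzeroV vecOf

  _≈P_ : P1pt → P1pt → Set (c ⊔ ℓ)
  p ≈P q = ∃ λ t → (¬ (t ≈ 0#)) × (P1pt.vecOf q ≈V (t ·V P1pt.vecOf p))

  numer : (a b c d x y z w : K) → K
  numer a b c d x y z w = (a * w - b * z) * (d * x - c * y)

  denom : (a b c d x y z w : K) → K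
  denom a b c d x y z w = (a * d - b * c) * (x * w - y * z)

-- An idempotent e of rank one with image [p] and kernel [q] is the projection onto p along q, and
-- Cramer's rule makes this explicit: (p ∧ q) · e v = (v ∧ q) · p.  Applying e f = λ h to p, which h
-- fixes, gives λ (p ∧ q)(x ∧ z) · p = (p ∧ z)(x ∧ q) · p, which is part (1).  In part (2) the map is
-- Q ↦ κ (X ∧ Q) / (P ∧ Q) with κ = (P ∧ Z) / (X ∧ Z) ≠ 0.  By the Plücker relation two values
-- agree exactly when Q ∧ Q′ = 0, i.e. [Q] = [Q′]; and along the line Q = s P + X the value is
-- linear in s, so every nonzero value is attained.

module Submission where

open import Defs
open import Level using (Level; _⊔_)
open import Data.Product using (Σ; ∃; _×_; _,_)
open import Function using (_∘_)
open import Relation.Nullary using (¬_)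
open import Algebra.Bundles using (CommutativeRing)
open import Relation.Binary.Bundles using (Setoid)

open import Data.Maybe using (Maybe; just; nothing)
open import Data.Nat as ℕ using (zero; suc)
open import Data.Integer as ℤ using (ℤ; +_; -[1+_]; _⊖_)
open import Data.Integer.Properties using ([1+m]⊖[1+n]≡m⊖n)
open import Data.Nat.Properties using (+-suc)
import Data.Sign as Sign
open import Relation.Binary.PropositionalEquality using (cong)
open import Relation.Nullary using (yes; no)
open import Algebra.Solver.Ring.AlmostCommutativeRing
  using (_-Raw-AlmostCommutative⟶_; fromCommutativeRing)
import Algebra.Solver.Ring
import Relation.Binary.Reasoning.Setoid as SetoidReasoning

-- Algebra.Solver.Ring only cancels coefficients it can decide equal, so it is instantiated with
-- integer coefficients through the canonical homomorphism ℤ → R.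
module IntegerCoefficientRingSolver {c ℓ : Level} (R : CommutativeRing c ℓ) where
  open CommutativeRing R
  open import Algebra.Properties.Semiring.Mult semiring using (×-homo-+; ×1-homo-*) renaming (_×_ to _×ₙ_)
  open import Algebra.Properties.Ring ring
    using (-‿involutive; -‿distribˡ-*; -‿distribʳ-*; -0#≈0#; -‿+-comm)
  open SetoidReasoning setoid

  fromℤ : ℤ → Carrier
  fromℤ (+ n)    = n ×ₙ 1#
  fromℤ -[1+ n ] = - (suc n ×ₙ 1#)

  fromℤ-⊖ : ∀ m n → fromℤ (m ⊖ n) ≈ m ×ₙ 1# - n ×ₙ 1#
  fromℤ-⊖ zero    zero    = sym (trans (+-congˡ -0#≈0#) (+-identityʳ 0#))
  fromℤ-⊖ zero    (suc n) = sym (+-identityˡ _)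
  fromℤ-⊖ (suc m) zero    = sym (trans (+-congˡ -0#≈0#) (+-identityʳ _))
  fromℤ-⊖ (suc m) (suc n) = begin
    fromℤ (suc m ⊖ suc n)           ≡⟨ cong fromℤ ([1+m]⊖[1+n]≡m⊖n m n) ⟩
    fromℤ (m ⊖ n)                   ≈⟨ fromℤ-⊖ m n ⟩
    a - b                           ≈⟨ +-identityˡ (a - b) ⟨
    0# + (a - b)                    ≈⟨ +-congʳ (-‿inverseʳ 1#) ⟨
    (1# - 1#) + (a - b)             ≈⟨ +-assoc 1# (- 1#) (a - b) ⟩
    1# + (- 1# + (a - b))           ≈⟨ +-congˡ (+-assoc (- 1#) a (- b)) ⟨
    1# + ((- 1# + a) - b)           ≈⟨ +-congˡ (+-congʳ (+-comm (- 1#) a)) ⟩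
    1# + ((a - 1#) - b)             ≈⟨ +-congˡ (+-assoc a (- 1#) (- b)) ⟩
    1# + (a + (- 1# - b))           ≈⟨ +-assoc 1# a (- 1# - b) ⟨
    (1# + a) + (- 1# - b)           ≈⟨ +-congˡ (-‿+-comm 1# b) ⟩
    (1# + a) - (1# + b)             ∎
    where
    a b : Carrier
    a = m ×ₙ 1#
    b = n ×ₙ 1#

  fromℤ-◃⁺ : ∀ n → fromℤ (Sign.+ ℤ.◃ n) ≈ n ×ₙ 1#
  fromℤ-◃⁺ zero    = refl
  fromℤ-◃⁺ (suc n) = refl

  fromℤ-◃⁻ : ∀ n → fromℤ (Sign.- ℤ.◃ n) ≈ - (n ×ₙ 1#)
  fromℤ-◃⁻ zero    = sym -0#≈0#
  fromℤ-◃⁻ (suc n) = refl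

  fromℤ-neg : ∀ i → fromℤ (ℤ.- i) ≈ - fromℤ i
  fromℤ-neg (+ zero)  = sym -0#≈0#
  fromℤ-neg (+ suc n) = refl
  fromℤ-neg -[1+ n ]  = sym (-‿involutive _)

  fromℤ-+ : ∀ i j → fromℤ (i ℤ.+ j) ≈ fromℤ i + fromℤ j
  fromℤ-+ -[1+ m ] -[1+ n ] = begin
    - (suc (suc (m ℕ.+ n)) ×ₙ 1#)       ≡⟨ cong (λ k → - (suc k ×ₙ 1#)) (+-suc m n) ⟨
    - ((suc m ℕ.+ suc n) ×ₙ 1#)         ≈⟨ -‿cong (×-homo-+ 1# (suc m) (suc n)) ⟩
    - (suc m ×ₙ 1# + suc n ×ₙ 1#)        ≈⟨ -‿+-comm _ _ ⟨
    - (suc m ×ₙ 1#) + - (suc n ×ₙ 1#)    ∎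
  fromℤ-+ -[1+ m ] (+ n)    = trans (fromℤ-⊖ n (suc m)) (+-comm _ _)
  fromℤ-+ (+ m)    -[1+ n ] = fromℤ-⊖ m (suc n)
  fromℤ-+ (+ m)    (+ n)    = ×-homo-+ 1# m n

  fromℤ-* : ∀ i j → fromℤ (i ℤ.* j) ≈ fromℤ i * fromℤ j
  fromℤ-* (+ m) (+ n) = trans (fromℤ-◃⁺ (m ℕ.* n)) (×1-homo-* m n)
  fromℤ-* (+ m) -[1+ n ] = begin
    fromℤ (Sign.- ℤ.◃ (m ℕ.* suc n))   ≈⟨ fromℤ-◃⁻ (m ℕ.* suc n) ⟩
    - ((m ℕ.* suc n) ×ₙ 1#)             ≈⟨ -‿cong (×1-homo-* m (suc n)) ⟩
    - (m ×ₙ 1# * suc n ×ₙ 1#)            ≈⟨ -‿distribʳ-* _ _ ⟩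
    m ×ₙ 1# * - (suc n ×ₙ 1#)            ∎
  fromℤ-* -[1+ m ] (+ n) = begin
    fromℤ (Sign.- ℤ.◃ (suc m ℕ.* n))   ≈⟨ fromℤ-◃⁻ (suc m ℕ.* n) ⟩
    - ((suc m ℕ.* n) ×ₙ 1#)             ≈⟨ -‿cong (×1-homo-* (suc m) n) ⟩
    - (suc m ×ₙ 1# * n ×ₙ 1#)            ≈⟨ -‿distribˡ-* _ _ ⟩
    - (suc m ×ₙ 1#) * n ×ₙ 1#            ∎
  fromℤ-* -[1+ m ] -[1+ n ] = begin
    fromℤ (Sign.+ ℤ.◃ (suc m ℕ.* suc n))    ≈⟨ fromℤ-◃⁺ (suc m ℕ.* suc n) ⟩
    (suc m ℕ.* suc n) ×ₙ 1#                  ≈⟨ ×1-homo-* (suc m) (suc n) ⟩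
    suc m ×ₙ 1# * suc n ×ₙ 1#                 ≈⟨ -‿involutive _ ⟨
    - - (suc m ×ₙ 1# * suc n ×ₙ 1#)           ≈⟨ -‿cong (-‿distribˡ-* _ _) ⟩
    - (- (suc m ×ₙ 1#) * suc n ×ₙ 1#)         ≈⟨ -‿distribʳ-* _ _ ⟩
    - (suc m ×ₙ 1#) * - (suc n ×ₙ 1#)         ∎

  ℤ⟶R : ℤ.+-*-rawRing -Raw-AlmostCommutative⟶ fromCommutativeRing R
  ℤ⟶R = record
    { ⟦_⟧    = fromℤ
    ; +-homo = fromℤ-+
    ; *-homo = fromℤ-*
    ; -‿homo = fromℤ-neg
    ; 0-homo = refl
    ; 1-homo = +-identityʳ 1#
    }

  fromℤ-≟ : ∀ i j → Maybe (fromℤ i ≈ fromℤ j)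
  fromℤ-≟ i j with i ℤ.≟ j
  ... | yes i≡j = just (reflexive (cong fromℤ i≡j))
  ... | no  _   = nothing

  open Algebra.Solver.Ring ℤ.+-*-rawRing (fromCommutativeRing R) ℤ⟶R fromℤ-≟ public

module PlaneVectors {c ℓ : Level} (R : CommutativeRing c ℓ) where
  open CommutativeRing R renaming (Carrier to K)
  open IntegerCoefficientRingSolver R using (solve; _:=_; _:+_; _:*_; _:-_; :-_; con)
  open import Algebra.Properties.Ring ring using (-0#≈0#)

  infix  4 _≈ᵥ_ _≈ₘ_
  infixl 6 _+ᵥ_
  infixr 7 _·ᵥ_ _·ₘ_ _*ᵥ_
  infixl 7 _*ₘ_
  infix  8 _∧_

  _≈ᵥ_ : V2 R → V2 R → Set ℓ
  _≈ᵥ_ = _≈V_ R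

  _≈ₘ_ : M2 R → M2 R → Set ℓ
  _≈ₘ_ = _≈M_ R

  _·ᵥ_ : K → V2 R → V2 R
  _·ᵥ_ = _·V_ R

  _·ₘ_ : K → M2 R → M2 R
  _·ₘ_ = _·M_ R

  _*ᵥ_ : M2 R → V2 R → V2 R
  _*ᵥ_ = _*MV_ R

  _*ₘ_ : M2 R → M2 R → M2 R
  _*ₘ_ = _*M_ R

  _+ᵥ_ : V2 R → V2 R → V2 R
  vec a b +ᵥ vec c d = vec (a + c) (b + d)

  _∧_ : V2 R → V2 R → K
  vec a b ∧ vec c d = a * d - b * c

  ≈ᵥ-setoid : Setoid c ℓ
  ≈ᵥ-setoid = record
    { Carrier       = V2 R
    ; _≈_           = _≈ᵥ_
    ; isEquivalence = record
      { refl  = refl , refl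
      ; sym   = λ (p₁ , p₂) → sym p₁ , sym p₂
      ; trans = λ (p₁ , p₂) (q₁ , q₂) → trans p₁ q₁ , trans p₂ q₂
      }
    }

  module ≈ᵥ = Setoid ≈ᵥ-setoid

  ·ᵥ-congˡ : ∀ {s t v} → s ≈ t → s ·ᵥ v ≈ᵥ t ·ᵥ v
  ·ᵥ-congˡ s≈t = *-congʳ s≈t , *-congʳ s≈t

  ·ᵥ-congʳ : ∀ {t u v} → u ≈ᵥ v → t ·ᵥ u ≈ᵥ t ·ᵥ v
  ·ᵥ-congʳ (p₁ , p₂) = *-congˡ p₁ , *-congˡ p₂

  +ᵥ-cong : ∀ {u u′ v v′} → u ≈ᵥ u′ → v ≈ᵥ v′ → u +ᵥ v ≈ᵥ u′ +ᵥ v′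
  +ᵥ-cong (p₁ , p₂) (q₁ , q₂) = +-cong p₁ q₁ , +-cong p₂ q₂

  *ᵥ-congˡ : ∀ {A u v} → u ≈ᵥ v → A *ᵥ u ≈ᵥ A *ᵥ v
  *ᵥ-congˡ (x , y) = +-cong (*-congˡ x) (*-congˡ y) , +-cong (*-congˡ x) (*-congˡ y)

  *ᵥ-congʳ : ∀ {A B v} → A ≈ₘ B → A *ᵥ v ≈ᵥ B *ᵥ v
  *ᵥ-congʳ (a , b , c , d) = +-cong (*-congʳ a) (*-congʳ b) , +-cong (*-congʳ c) (*-congʳ d)

  ∧-cong : ∀ {u u′ v v′} → u ≈ᵥ u′ → v ≈ᵥ v′ → u ∧ v ≈ u′ ∧ v′
  ∧-cong (a , b) (c , d) = +-cong (*-cong a d) (-‿cong (*-cong b c))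

  ·ᵥ-assoc : ∀ s t v → (s * t) ·ᵥ v ≈ᵥ s ·ᵥ t ·ᵥ v
  ·ᵥ-assoc s t (vec x y) = *-assoc s t x , *-assoc s t y

  ·ᵥ-identityˡ : ∀ v → 1# ·ᵥ v ≈ᵥ v
  ·ᵥ-identityˡ (vec x y) = *-identityˡ x , *-identityˡ y

  ·ᵥ-zeroˡ : ∀ v → 0# ·ᵥ v ≈ᵥ 0V R
  ·ᵥ-zeroˡ (vec x y) = zeroˡ x , zeroˡ y

  ·ᵥ-zeroʳ : ∀ t → t ·ᵥ 0V R ≈ᵥ 0V R
  ·ᵥ-zeroʳ t = zeroʳ t , zeroʳ t

  +ᵥ-identityˡ : ∀ v → 0V R +ᵥ v ≈ᵥ v
  +ᵥ-identityˡ (vec x y) = +-identityˡ x , +-identityˡ y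

  +ᵥ-identityʳ : ∀ v → v +ᵥ 0V R ≈ᵥ v
  +ᵥ-identityʳ (vec x y) = +-identityʳ x , +-identityʳ y

  *ᵥ-·ᵥ : ∀ A t v → A *ᵥ t ·ᵥ v ≈ᵥ t ·ᵥ A *ᵥ v
  *ᵥ-·ᵥ (mat a b c d) t (vec x y) = row a b , row c d
    where
    row : ∀ a b → a * (t * x) + b * (t * y) ≈ t * (a * x + b * y)
    row a b = solve 5 (λ a b t x y → a :* (t :* x) :+ b :* (t :* y) := t :* (a :* x :+ b :* y))
                refl a b t x y

  *ᵥ-+ᵥ : ∀ A u v → A *ᵥ (u +ᵥ v) ≈ᵥ A *ᵥ u +ᵥ A *ᵥ v
  *ᵥ-+ᵥ (mat a b c d) (vec x y) (vec x′ y′) = row a b , row c d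
    where
    row : ∀ a b → a * (x + x′) + b * (y + y′) ≈ (a * x + b * y) + (a * x′ + b * y′)
    row a b = solve 6 (λ a b x y x′ y′ →
                a :* (x :+ x′) :+ b :* (y :+ y′) := (a :* x :+ b :* y) :+ (a :* x′ :+ b :* y′))
                refl a b x y x′ y′

  ·ₘ-*ᵥ : ∀ t A v → (t ·ₘ A) *ᵥ v ≈ᵥ t ·ᵥ A *ᵥ v
  ·ₘ-*ᵥ t (mat a b c d) (vec x y) = row a b , row c d
    where
    row : ∀ a b → (t * a) * x + (t * b) * y ≈ t * (a * x + b * y)
    row a b = solve 5 (λ t a b x y → (t :* a) :* x :+ (t :* b) :* y := t :* (a :* x :+ b :* y))
                refl t a b x y

  *ₘ-*ᵥ : ∀ A B v → (A *ₘ B) *ᵥ v ≈ᵥ A *ᵥ B *ᵥ v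
  *ₘ-*ᵥ (mat a b c d) (mat p q r s) (vec x y) = row a b , row c d
    where
    row : ∀ a b → (a * p + b * r) * x + (a * q + b * s) * y ≈ a * (p * x + q * y) + b * (r * x + s * y)
    row a b = solve 8 (λ a b p q r s x y →
                (a :* p :+ b :* r) :* x :+ (a :* q :+ b :* s) :* y
                  := a :* (p :* x :+ q :* y) :+ b :* (r :* x :+ s :* y))
                refl a b p q r s x y

  ∧-·ᵥˡ : ∀ t u v → (t ·ᵥ u) ∧ v ≈ t * (u ∧ v)
  ∧-·ᵥˡ t (vec a b) (vec c d) =
    solve 5 (λ t a b c d → (t :* a) :* d :- (t :* b) :* c := t :* (a :* d :- b :* c)) refl t a b c d

  ∧-·ᵥʳ : ∀ t u v → u ∧ (t ·ᵥ v) ≈ t * (u ∧ v)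
  ∧-·ᵥʳ t (vec a b) (vec c d) =
    solve 5 (λ t a b c d → a :* (t :* d) :- b :* (t :* c) := t :* (a :* d :- b :* c)) refl t a b c d

  ∧-self : ∀ u → u ∧ u ≈ 0#
  ∧-self (vec a b) = solve 2 (λ a b → a :* b :- b :* a := con (+ 0)) refl a b

  ∧-antisym : ∀ u v → u ∧ v ≈ - (v ∧ u)
  ∧-antisym (vec a b) (vec c d) =
    solve 4 (λ a b c d → a :* d :- b :* c := :- (c :* b :- d :* a)) refl a b c d

  ∧-zeroʳ : ∀ u → u ∧ 0V R ≈ 0#
  ∧-zeroʳ (vec a b) = solve 2 (λ a b → a :* con (+ 0) :- b :* con (+ 0) := con (+ 0)) refl a b

  ∧-distribˡ-+ᵥ : ∀ u v w → u ∧ (v +ᵥ w) ≈ u ∧ v + u ∧ w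
  ∧-distribˡ-+ᵥ (vec a b) (vec c d) (vec e f) =
    solve 6 (λ a b c d e f → a :* (d :+ f) :- b :* (c :+ e) := (a :* d :- b :* c) :+ (a :* f :- b :* e))
      refl a b c d e f

  cramer : ∀ p q v → (p ∧ q) ·ᵥ v ≈ᵥ (v ∧ q) ·ᵥ p +ᵥ (p ∧ v) ·ᵥ q
  cramer (vec a b) (vec c d) (vec x y) =
    solve 6 (λ a b c d x y →
      (a :* d :- b :* c) :* x := (x :* d :- y :* c) :* a :+ (a :* y :- b :* x) :* c) refl a b c d x y ,
    solve 6 (λ a b c d x y →
      (a :* d :- b :* c) :* y := (x :* d :- y :* c) :* b :+ (a :* y :- b :* x) :* d) refl a b c d x y

  plücker : ∀ u v w s → (u ∧ v) * (w ∧ s) - (u ∧ s) * (w ∧ v) ≈ (u ∧ w) * (v ∧ s)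
  plücker (vec a b) (vec c d) (vec e f) (vec g h) = solve 8 (λ a b c d e f g h →
    (a :* d :- b :* c) :* (e :* h :- f :* g) :- (a :* h :- b :* g) :* (e :* d :- f :* c)
      := (a :* f :- b :* e) :* (c :* h :- d :* g)) refl a b c d e f g h

  -- `denom R a b c d x y z w` is definitionally (vec a b ∧ vec c d) * (vec x y ∧ vec z w).
  numer-as-∧ : ∀ a b c d x y z w → numer R a b c d x y z w ≈ (vec a b ∧ vec z w) * (vec x y ∧ vec c d)
  numer-as-∧ a b c d x y z w = *-congˡ (+-cong (*-comm d x) (-‿cong (*-comm c y)))

  ∧≈0⇒proportional : ∀ r {u v} → u ∧ v ≈ 0# → (r ∧ u) ·ᵥ v ≈ᵥ (r ∧ v) ·ᵥ u
  ∧≈0⇒proportional r {u} {v} u∧v≈0 = begin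
    (r ∧ u) ·ᵥ v                       ≈⟨ cramer r u v ⟩
    (v ∧ u) ·ᵥ r +ᵥ (r ∧ v) ·ᵥ u       ≈⟨ +ᵥ-cong (·ᵥ-congˡ v∧u≈0) ≈ᵥ.refl ⟩
    0# ·ᵥ r +ᵥ (r ∧ v) ·ᵥ u            ≈⟨ +ᵥ-cong (·ᵥ-zeroˡ r) ≈ᵥ.refl ⟩
    0V R +ᵥ (r ∧ v) ·ᵥ u               ≈⟨ +ᵥ-identityˡ _ ⟩
    (r ∧ v) ·ᵥ u                       ∎
    where
    open SetoidReasoning ≈ᵥ-setoid
    v∧u≈0 : v ∧ u ≈ 0#
    v∧u≈0 = trans (∧-antisym v u) (trans (-‿cong u∧v≈0) -0#≈0#)

  idempotent-fixes-image : ∀ {A w} → IsIdempotent R A → InImage R A w → A *ᵥ w ≈ᵥ w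
  idempotent-fixes-image {A} {w} A²≈A (u , Au≈w) = begin
    A *ᵥ w             ≈⟨ *ᵥ-congˡ Au≈w ⟨
    A *ᵥ A *ᵥ u        ≈⟨ *ₘ-*ᵥ A A u ⟨
    (A *ₘ A) *ᵥ u      ≈⟨ *ᵥ-congʳ A²≈A ⟩
    A *ᵥ u             ≈⟨ Au≈w ⟩
    w                  ∎
    where open SetoidReasoning ≈ᵥ-setoid

  projection-formula : ∀ {A p q} → A *ᵥ p ≈ᵥ p → A *ᵥ q ≈ᵥ 0V R →
                       ∀ v → (p ∧ q) ·ᵥ A *ᵥ v ≈ᵥ (v ∧ q) ·ᵥ p
  projection-formula {A} {p} {q} Ap≈p Aq≈0 v = begin
    (p ∧ q) ·ᵥ A *ᵥ v                           ≈⟨ *ᵥ-·ᵥ A (p ∧ q) v ⟨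
    A *ᵥ (p ∧ q) ·ᵥ v                           ≈⟨ *ᵥ-congˡ (cramer p q v) ⟩
    A *ᵥ ((v ∧ q) ·ᵥ p +ᵥ (p ∧ v) ·ᵥ q)         ≈⟨ *ᵥ-+ᵥ A _ _ ⟩
    A *ᵥ (v ∧ q) ·ᵥ p +ᵥ A *ᵥ (p ∧ v) ·ᵥ q      ≈⟨ +ᵥ-cong (*ᵥ-·ᵥ A _ p) (*ᵥ-·ᵥ A _ q) ⟩
    (v ∧ q) ·ᵥ A *ᵥ p +ᵥ (p ∧ v) ·ᵥ A *ᵥ q      ≈⟨ +ᵥ-cong (·ᵥ-congʳ Ap≈p) (·ᵥ-congʳ Aq≈0) ⟩
    (v ∧ q) ·ᵥ p +ᵥ (p ∧ v) ·ᵥ 0V R             ≈⟨ +ᵥ-cong ≈ᵥ.refl (·ᵥ-zeroʳ _) ⟩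
    (v ∧ q) ·ᵥ p +ᵥ 0V R                        ≈⟨ +ᵥ-identityʳ _ ⟩
    (v ∧ q) ·ᵥ p                                ∎
    where open SetoidReasoning ≈ᵥ-setoid

module FieldProperties {c ℓ : Level} (R : CommutativeRing c ℓ) (F : IsField R) where
  open CommutativeRing R renaming (Carrier to K)
  open IsField F
  open IntegerCoefficientRingSolver R using (solve; _:=_; _:*_)
  open SetoidReasoning setoid

  x*y*y⁻¹≈x : ∀ x y (y≉0 : ¬ y ≈ 0#) → (x * y) * inv y y≉0 ≈ x
  x*y*y⁻¹≈x x y y≉0 = trans (*-assoc x y _) (trans (*-congˡ (inv-r y y≉0)) (*-identityʳ x))

  x*y⁻¹*y≈x : ∀ x y (y≉0 : ¬ y ≈ 0#) → (x * inv y y≉0) * y ≈ x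
  x*y⁻¹*y≈x x y y≉0 = begin
    (x * inv y y≉0) * y    ≈⟨ solve 3 (λ x i y → (x :* i) :* y := (x :* y) :* i) refl x (inv y y≉0) y ⟩
    (x * y) * inv y y≉0    ≈⟨ x*y*y⁻¹≈x x y y≉0 ⟩
    x                      ∎

  *-cancelʳ-≉0 : ∀ {x y z} → ¬ z ≈ 0# → x * z ≈ y * z → x ≈ y
  *-cancelʳ-≉0 {x} {y} {z} z≉0 xz≈yz = begin
    x                      ≈⟨ x*y*y⁻¹≈x x z z≉0 ⟨
    (x * z) * inv z z≉0    ≈⟨ *-congʳ xz≈yz ⟩
    (y * z) * inv z z≉0    ≈⟨ x*y*y⁻¹≈x y z z≉0 ⟩
    y                      ∎

  x≉0⇒x*y≈0⇒y≈0 : ∀ {x y} → ¬ x ≈ 0# → x * y ≈ 0# → y ≈ 0#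
  x≉0⇒x*y≈0⇒y≈0 {x} {y} x≉0 xy≈0 =
    *-cancelʳ-≉0 x≉0 (trans (*-comm y x) (trans xy≈0 (sym (zeroˡ x))))

  x*y≉0 : ∀ {x y} → ¬ x ≈ 0# → ¬ y ≈ 0# → ¬ x * y ≈ 0#
  x*y≉0 x≉0 y≉0 xy≈0 = y≉0 (x≉0⇒x*y≈0⇒y≈0 x≉0 xy≈0)

  x≈y*z⇒x*z⁻¹≈y : ∀ {x y z} (z≉0 : ¬ z ≈ 0#) → x ≈ y * z → x * inv z z≉0 ≈ y
  x≈y*z⇒x*z⁻¹≈y {y = y} {z} z≉0 x≈yz = trans (*-congʳ x≈yz) (x*y*y⁻¹≈x y z z≉0)

  x≉0⇒x*y⁻¹≉0 : ∀ {x y} (y≉0 : ¬ y ≈ 0#) → ¬ x ≈ 0# → ¬ x * inv y y≉0 ≈ 0#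
  x≉0⇒x*y⁻¹≉0 {x} {y} y≉0 x≉0 x/y≈0 =
    x≉0 (trans (sym (x*y⁻¹*y≈x x y y≉0)) (trans (*-congʳ x/y≈0) (zeroˡ y)))

  cross-multiply : ∀ {x y u v} (y≉0 : ¬ y ≈ 0#) (v≉0 : ¬ v ≈ 0#) →
                   x * v ≈ u * y → x * inv y y≉0 ≈ u * inv v v≉0
  cross-multiply {x} {y} {u} {v} y≉0 v≉0 xv≈uy = *-cancelʳ-≉0 v≉0 (begin
    (x * inv y y≉0) * v    ≈⟨ solve 3 (λ x i v → (x :* i) :* v := (x :* v) :* i) refl x (inv y y≉0) v ⟩
    (x * v) * inv y y≉0    ≈⟨ x≈y*z⇒x*z⁻¹≈y y≉0 xv≈uy ⟩
    u                      ≈⟨ x*y⁻¹*y≈x u v v≉0 ⟨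
    (u * inv v v≉0) * v    ∎)

  uncross-multiply : ∀ {x y u v} (y≉0 : ¬ y ≈ 0#) (v≉0 : ¬ v ≈ 0#) →
                     x * inv y y≉0 ≈ u * inv v v≉0 → x * v ≈ u * y
  uncross-multiply {x} {y} {u} {v} y≉0 v≉0 x/y≈u/v = begin
    x * v                          ≈⟨ *-congʳ (x*y⁻¹*y≈x x y y≉0) ⟨
    ((x * inv y y≉0) * y) * v      ≈⟨ *-congʳ (*-congʳ x/y≈u/v) ⟩
    ((u * inv v v≉0) * y) * v      ≈⟨ solve 3 (λ w y v → (w :* y) :* v := (w :* v) :* y)
                                           refl (u * inv v v≉0) y v ⟩
    ((u * inv v v≉0) * v) * y      ≈⟨ *-congʳ (x*y⁻¹*y≈x u v v≉0) ⟩
    u * y                          ∎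

module ProjectiveLine {c ℓ : Level} (R : CommutativeRing c ℓ) (F : IsField R) where
  open CommutativeRing R renaming (Carrier to K)
  open IsField F
  open PlaneVectors R
  open FieldProperties R F
  open import Algebra.Properties.Ring ring using (-0#≈0#; -‿involutive)

  -- One of the standard basis vectors is transversal to u (r ∧ u ≉ 0), but constructively we
  -- only know this up to double negation.
  nonzero⇒¬¬transversal : ∀ {u} → NonzeroV R u → ¬ ¬ (∃ λ r → ¬ r ∧ u ≈ 0#)
  nonzero⇒¬¬transversal {vec a b} u≉0 no-transversal =
    ¬¬a≈0 (λ a≈0 → ¬¬b≈0 (λ b≈0 → u≉0 (a≈0 , b≈0)))
    where
    e₁∧u≈b : vec 1# 0# ∧ vec a b ≈ b
    e₁∧u≈b = trans (+-cong (*-identityˡ b) (trans (-‿cong (zeroˡ a)) -0#≈0#)) (+-identityʳ b)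
    e₂∧u≈-a : vec 0# 1# ∧ vec a b ≈ - a
    e₂∧u≈-a = trans (+-cong (zeroˡ b) (-‿cong (*-identityˡ a))) (+-identityˡ (- a))
    ¬¬a≈0 : ¬ ¬ a ≈ 0#
    ¬¬a≈0 a≉0 = no-transversal (vec 0# 1# , λ e₂∧u≈0 →
      a≉0 (trans (sym (-‿involutive a)) (trans (-‿cong (trans (sym e₂∧u≈-a) e₂∧u≈0)) -0#≈0#)))
    ¬¬b≈0 : ¬ ¬ b ≈ 0#
    ¬¬b≈0 b≉0 = no-transversal (vec 1# 0# , λ e₁∧u≈0 → b≉0 (trans (sym e₁∧u≈b) e₁∧u≈0))

  proportional⇒≈P : ∀ {u v t} (u≉0 : NonzeroV R u) (v≉0 : NonzeroV R v) →
                    v ≈ᵥ t ·ᵥ u → _≈P_ R (pt u u≉0) (pt v v≉0)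
  proportional⇒≈P {u} {v} {t} _ v≉0 v≈tu = t , t≉0 , v≈tu
    where
    t≉0 : ¬ t ≈ 0#
    t≉0 t≈0 = v≉0 (≈ᵥ.trans v≈tu (≈ᵥ.trans (·ᵥ-congˡ t≈0) (·ᵥ-zeroˡ u)))

  ≈P⇒∧≈0 : ∀ {u v} (u≉0 : NonzeroV R u) (v≉0 : NonzeroV R v) →
           _≈P_ R (pt u u≉0) (pt v v≉0) → u ∧ v ≈ 0#
  ≈P⇒∧≈0 {u} _ _ (t , _ , v≈tu) = begin
    u ∧ _          ≈⟨ ∧-cong ≈ᵥ.refl v≈tu ⟩
    u ∧ (t ·ᵥ u)   ≈⟨ ∧-·ᵥʳ t u u ⟩
    t * (u ∧ u)    ≈⟨ *-congˡ (∧-self u) ⟩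
    t * 0#         ≈⟨ zeroʳ t ⟩
    0#             ∎
    where open SetoidReasoning setoid

  ∧≈0⇒scalar-multiple : ∀ {r u v} (r∧u≉0 : ¬ r ∧ u ≈ 0#) → u ∧ v ≈ 0# →
                        v ≈ᵥ (inv (r ∧ u) r∧u≉0 * (r ∧ v)) ·ᵥ u
  ∧≈0⇒scalar-multiple {r} {u} {v} r∧u≉0 u∧v≈0 = begin
    v                                 ≈⟨ ·ᵥ-identityˡ v ⟨
    1# ·ᵥ v                           ≈⟨ ·ᵥ-congˡ (trans (*-comm _ _) (inv-r (r ∧ u) r∧u≉0)) ⟨
    (inv (r ∧ u) r∧u≉0 * (r ∧ u)) ·ᵥ v  ≈⟨ ·ᵥ-assoc _ _ v ⟩
    inv (r ∧ u) r∧u≉0 ·ᵥ (r ∧ u) ·ᵥ v   ≈⟨ ·ᵥ-congʳ (∧≈0⇒proportional r u∧v≈0) ⟩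
    inv (r ∧ u) r∧u≉0 ·ᵥ (r ∧ v) ·ᵥ u   ≈⟨ ·ᵥ-assoc _ _ u ⟨
    (inv (r ∧ u) r∧u≉0 * (r ∧ v)) ·ᵥ u  ∎
    where open SetoidReasoning ≈ᵥ-setoid

  ≉P⇒∧≉0 : ∀ {u v} (u≉0 : NonzeroV R u) (v≉0 : NonzeroV R v) →
           ¬ _≈P_ R (pt u u≉0) (pt v v≉0) → ¬ u ∧ v ≈ 0#
  ≉P⇒∧≉0 u≉0 v≉0 [u]≉[v] u∧v≈0 = nonzero⇒¬¬transversal u≉0 λ (r , r∧u≉0) →
    [u]≉[v] (proportional⇒≈P u≉0 v≉0 (∧≈0⇒scalar-multiple r∧u≉0 u∧v≈0))

  ∧≉0-swap : ∀ {u v} → ¬ u ∧ v ≈ 0# → ¬ v ∧ u ≈ 0#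
  ∧≉0-swap {u} {v} u∧v≉0 v∧u≈0 =
    u∧v≉0 (trans (∧-antisym u v) (trans (-‿cong v∧u≈0) -0#≈0#))

  ·ᵥ-cancelʳ : ∀ {s t v q} → ¬ v ∧ q ≈ 0# → s ·ᵥ v ≈ᵥ t ·ᵥ v → s ≈ t
  ·ᵥ-cancelʳ {s} {t} {v} {q} v∧q≉0 sv≈tv = *-cancelʳ-≉0 v∧q≉0
    (trans (sym (∧-·ᵥˡ s v q)) (trans (∧-cong sv≈tv ≈ᵥ.refl) (∧-·ᵥˡ t v q)))

module IdempotentProducts {c ℓ : Level} (R : CommutativeRing c ℓ) (F : IsField R) where
  open CommutativeRing R renaming (Carrier to K)
  open PlaneVectors R
  open FieldProperties R F
  open ProjectiveLine R F

  span-self : ∀ v → InSpan R v v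
  span-self (vec x y) = 1# , sym (*-identityˡ x) , sym (*-identityˡ y)

  image-fixed : ∀ {A p} → IsIdempotent R A → ImageSpannedBy R A p → A *ᵥ p ≈ᵥ p
  image-fixed A²≈A (_ , _ , span⊆image) = idempotent-fixes-image A²≈A (span⊆image _ (span-self _))

  kernel-killed : ∀ {A q} → KernelSpannedBy R A q → A *ᵥ q ≈ᵥ 0V R
  kernel-killed (_ , _ , span⊆kernel) = span⊆kernel _ (span-self _)

  image∧kernel≉0 : ∀ {A p q} → NonzeroV R p → NonzeroV R q →
                   A *ᵥ p ≈ᵥ p → A *ᵥ q ≈ᵥ 0V R → ¬ p ∧ q ≈ 0#
  image∧kernel≉0 {A} {p} {q} p≉0 q≉0 Ap≈p Aq≈0 = ≉P⇒∧≉0 p≉0 q≉0 [p]≉[q]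
    where
    [p]≉[q] : ¬ _≈P_ R (pt p p≉0) (pt q q≉0)
    [p]≉[q] (t , _ , q≈tp) = q≉0 (begin
      q              ≈⟨ q≈tp ⟩
      t ·ᵥ p         ≈⟨ ·ᵥ-congʳ Ap≈p ⟨
      t ·ᵥ A *ᵥ p    ≈⟨ *ᵥ-·ᵥ A t p ⟨
      A *ᵥ t ·ᵥ p    ≈⟨ *ᵥ-congˡ q≈tp ⟨
      A *ᵥ q         ≈⟨ Aq≈0 ⟩
      0V R           ∎)
      where open SetoidReasoning ≈ᵥ-setoid

  idempotent-product-coefficient : ∀ {e f h λ′ P Q X Z} →
    IsIdempotent R e → IsIdempotent R f → IsIdempotent R h → e *ₘ f ≈ₘ λ′ ·ₘ h →
    πIs R e P Q → πIs R f X Z → ImageSpannedBy R h P →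
    ¬ (P ∧ Q) * (X ∧ Z) ≈ 0# × λ′ * ((P ∧ Q) * (X ∧ Z)) ≈ (P ∧ Z) * (X ∧ Q)
  idempotent-product-coefficient {e} {f} {h} {λ′} {P} {Q} {X} {Z} e²≈e f²≈f h²≈h ef≈λh
    (imᵉ@(P≉0 , _) , kerᵉ@(Q≉0 , _)) (imᶠ@(X≉0 , _) , kerᶠ@(Z≉0 , _)) imʰ =
    x*y≉0 P∧Q≉0 X∧Z≉0 , ·ᵥ-cancelʳ P∧Q≉0 (begin
      (λ′ * ((P ∧ Q) * (X ∧ Z))) ·ᵥ P        ≈⟨ ·ᵥ-congˡ (*-comm λ′ _) ⟩
      ((P ∧ Q) * (X ∧ Z) * λ′) ·ᵥ P          ≈⟨ ·ᵥ-assoc _ λ′ P ⟩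
      ((P ∧ Q) * (X ∧ Z)) ·ᵥ λ′ ·ᵥ P         ≈⟨ ·ᵥ-congʳ efP≈λP ⟨
      ((P ∧ Q) * (X ∧ Z)) ·ᵥ e *ᵥ f *ᵥ P     ≈⟨ ·ᵥ-assoc _ _ _ ⟩
      (P ∧ Q) ·ᵥ (X ∧ Z) ·ᵥ e *ᵥ f *ᵥ P      ≈⟨ ·ᵥ-congʳ (*ᵥ-·ᵥ e _ _) ⟨
      (P ∧ Q) ·ᵥ e *ᵥ (X ∧ Z) ·ᵥ f *ᵥ P      ≈⟨ ·ᵥ-congʳ (*ᵥ-congˡ (projection-formula fX≈X fZ≈0 P)) ⟩
      (P ∧ Q) ·ᵥ e *ᵥ (P ∧ Z) ·ᵥ X           ≈⟨ ·ᵥ-congʳ (*ᵥ-·ᵥ e _ X) ⟩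
      (P ∧ Q) ·ᵥ (P ∧ Z) ·ᵥ e *ᵥ X           ≈⟨ ·ᵥ-assoc _ _ _ ⟨
      ((P ∧ Q) * (P ∧ Z)) ·ᵥ e *ᵥ X          ≈⟨ ·ᵥ-congˡ (*-comm _ _) ⟩
      ((P ∧ Z) * (P ∧ Q)) ·ᵥ e *ᵥ X          ≈⟨ ·ᵥ-assoc _ _ _ ⟩
      (P ∧ Z) ·ᵥ (P ∧ Q) ·ᵥ e *ᵥ X           ≈⟨ ·ᵥ-congʳ (projection-formula eP≈P eQ≈0 X) ⟩
      (P ∧ Z) ·ᵥ (X ∧ Q) ·ᵥ P                ≈⟨ ·ᵥ-assoc _ _ P ⟨
      ((P ∧ Z) * (X ∧ Q)) ·ᵥ P               ∎)
    where
    open SetoidReasoning ≈ᵥ-setoid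
    eP≈P : e *ᵥ P ≈ᵥ P
    eP≈P = image-fixed e²≈e imᵉ
    eQ≈0 : e *ᵥ Q ≈ᵥ 0V R
    eQ≈0 = kernel-killed kerᵉ
    fX≈X : f *ᵥ X ≈ᵥ X
    fX≈X = image-fixed f²≈f imᶠ
    fZ≈0 : f *ᵥ Z ≈ᵥ 0V R
    fZ≈0 = kernel-killed kerᶠ
    P∧Q≉0 : ¬ P ∧ Q ≈ 0#
    P∧Q≉0 = image∧kernel≉0 P≉0 Q≉0 eP≈P eQ≈0
    X∧Z≉0 : ¬ X ∧ Z ≈ 0#
    X∧Z≉0 = image∧kernel≉0 X≉0 Z≉0 fX≈X fZ≈0
    efP≈λP : e *ᵥ f *ᵥ P ≈ᵥ λ′ ·ᵥ P
    efP≈λP = begin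
      e *ᵥ f *ᵥ P       ≈⟨ *ₘ-*ᵥ e f P ⟨
      (e *ₘ f) *ᵥ P     ≈⟨ *ᵥ-congʳ ef≈λh ⟩
      (λ′ ·ₘ h) *ᵥ P    ≈⟨ ·ₘ-*ᵥ λ′ h P ⟩
      λ′ ·ᵥ h *ᵥ P      ≈⟨ ·ᵥ-congʳ (image-fixed h²≈h imʰ) ⟩
      λ′ ·ᵥ P           ∎

module CrossRatio {c ℓ : Level} (R : CommutativeRing c ℓ) (F : IsField R)
  (a b x y z w : CommutativeRing.Carrier R)
  (nab : NonzeroV R (vec a b)) (nxy : NonzeroV R (vec x y)) (nzw : NonzeroV R (vec z w))
  (nPX : ¬ _≈P_ R (pt (vec a b) nab) (pt (vec x y) nxy))
  (nPZ : ¬ _≈P_ R (pt (vec a b) nab) (pt (vec z w) nzw))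
  (nXZ : ¬ _≈P_ R (pt (vec x y) nxy) (pt (vec z w) nzw)) where
  open CommutativeRing R renaming (Carrier to K)
  open IsField F
  open PlaneVectors R
  open FieldProperties R F
  open ProjectiveLine R F
  open IntegerCoefficientRingSolver R using (solve; _:=_; _:*_; _:-_; :-_)
  open import Algebra.Properties.Ring ring using (x≈y⇒x∙y⁻¹≈ε)
  open SetoidReasoning setoid

  P X Z : V2 R
  P = vec a b
  X = vec x y
  Z = vec z w

  P∧X≉0 : ¬ P ∧ X ≈ 0#
  P∧X≉0 = ≉P⇒∧≉0 nab nxy nPX

  P∧Z≉0 : ¬ P ∧ Z ≈ 0#
  P∧Z≉0 = ≉P⇒∧≉0 nab nzw nPZ

  X∧Z≉0 : ¬ X ∧ Z ≈ 0#
  X∧Z≉0 = ≉P⇒∧≉0 nxy nzw nXZ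

  numerator : V2 R → K
  numerator Q = (P ∧ Z) * (X ∧ Q)

  denominator : V2 R → K
  denominator Q = (P ∧ Q) * (X ∧ Z)

  numer≈numerator : ∀ c d → numer R a b c d x y z w ≈ numerator (vec c d)
  numer≈numerator c d = numer-as-∧ a b c d x y z w

  cross-ratio-invariant : ∀ {Q Q′ t} → Q′ ≈ᵥ t ·ᵥ Q →
                          numerator Q * denominator Q′ ≈ numerator Q′ * denominator Q
  cross-ratio-invariant {Q} {Q′} {t} Q′≈tQ = begin
    ((P ∧ Z) * (X ∧ Q)) * ((P ∧ Q′) * (X ∧ Z))         ≈⟨ *-congˡ (*-congʳ (∧-scaled P)) ⟩
    ((P ∧ Z) * (X ∧ Q)) * ((t * (P ∧ Q)) * (X ∧ Z))    ≈⟨ solve 5 (λ pz xq t pq xz →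
                                                             (pz :* xq) :* ((t :* pq) :* xz)
                                                               := (pz :* (t :* xq)) :* (pq :* xz))
                                                             refl (P ∧ Z) (X ∧ Q) t (P ∧ Q) (X ∧ Z) ⟩
    ((P ∧ Z) * (t * (X ∧ Q))) * ((P ∧ Q) * (X ∧ Z))    ≈⟨ *-congʳ (*-congˡ (∧-scaled X)) ⟨
    ((P ∧ Z) * (X ∧ Q′)) * ((P ∧ Q) * (X ∧ Z))         ∎
    where
    ∧-scaled : ∀ u → u ∧ Q′ ≈ t * (u ∧ Q)
    ∧-scaled u = trans (∧-cong ≈ᵥ.refl Q′≈tQ) (∧-·ᵥʳ t u Q)

  cross-ratio-injective : ∀ {Q Q′} → numerator Q * denominator Q′ ≈ numerator Q′ * denominator Q →
                          Q ∧ Q′ ≈ 0#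
  cross-ratio-injective {Q} {Q′} cross =
    x≉0⇒x*y≈0⇒y≈0 (∧≉0-swap P∧X≉0) (x≉0⇒x*y≈0⇒y≈0 (x*y≉0 P∧Z≉0 X∧Z≉0) (begin
      ((P ∧ Z) * (X ∧ Z)) * ((X ∧ P) * (Q ∧ Q′))
        ≈⟨ *-congˡ (plücker X Q P Q′) ⟨
      ((P ∧ Z) * (X ∧ Z)) * ((X ∧ Q) * (P ∧ Q′) - (X ∧ Q′) * (P ∧ Q))
        ≈⟨ solve 6 (λ pz xz xq pq′ xq′ pq →
             (pz :* xz) :* (xq :* pq′ :- xq′ :* pq)
               := (pz :* xq) :* (pq′ :* xz) :- (pz :* xq′) :* (pq :* xz))
             refl (P ∧ Z) (X ∧ Z) (X ∧ Q) (P ∧ Q′) (X ∧ Q′) (P ∧ Q) ⟩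
      numerator Q * denominator Q′ - numerator Q′ * denominator Q
        ≈⟨ x≈y⇒x∙y⁻¹≈ε cross ⟩
      0# ∎))

  -- Q = s P + X has P ∧ Q = P ∧ X and X ∧ Q = s (X ∧ P), so the cross ratio of Q is
  -- s (Z ∧ P) / (X ∧ Z), which is linear in s.
  preimage-scalar : K → K
  preimage-scalar μ = (μ * (X ∧ Z)) * inv (Z ∧ P) (∧≉0-swap P∧Z≉0)

  preimage : K → V2 R
  preimage μ = preimage-scalar μ ·ᵥ P +ᵥ X

  P∧preimage : ∀ μ → P ∧ preimage μ ≈ P ∧ X
  P∧preimage μ = begin
    P ∧ (s ·ᵥ P +ᵥ X)        ≈⟨ ∧-distribˡ-+ᵥ P (s ·ᵥ P) X ⟩
    P ∧ (s ·ᵥ P) + P ∧ X     ≈⟨ +-congʳ (∧-·ᵥʳ s P P) ⟩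
    s * (P ∧ P) + P ∧ X      ≈⟨ +-congʳ (trans (*-congˡ (∧-self P)) (zeroʳ s)) ⟩
    0# + P ∧ X               ≈⟨ +-identityˡ (P ∧ X) ⟩
    P ∧ X                    ∎
    where
    s : K
    s = preimage-scalar μ

  X∧preimage : ∀ μ → X ∧ preimage μ ≈ preimage-scalar μ * (X ∧ P)
  X∧preimage μ = begin
    X ∧ (s ·ᵥ P +ᵥ X)        ≈⟨ ∧-distribˡ-+ᵥ X (s ·ᵥ P) X ⟩
    X ∧ (s ·ᵥ P) + X ∧ X     ≈⟨ +-cong (∧-·ᵥʳ s X P) (∧-self X) ⟩
    s * (X ∧ P) + 0#         ≈⟨ +-identityʳ _ ⟩
    s * (X ∧ P)              ∎
    where
    s : K
    s = preimage-scalar μ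

  preimage-scalar≉0 : ∀ {μ} → ¬ μ ≈ 0# → ¬ preimage-scalar μ ≈ 0#
  preimage-scalar≉0 μ≉0 = x≉0⇒x*y⁻¹≉0 (∧≉0-swap P∧Z≉0) (x*y≉0 μ≉0 X∧Z≉0)

  numerator-preimage : ∀ μ → numerator (preimage μ) ≈ μ * denominator (preimage μ)
  numerator-preimage μ = begin
    (P ∧ Z) * (X ∧ preimage μ)        ≈⟨ *-congˡ (X∧preimage μ) ⟩
    (P ∧ Z) * (s * (X ∧ P))           ≈⟨ *-cong (∧-antisym P Z) (*-congˡ (∧-antisym X P)) ⟩
    (- (Z ∧ P)) * (s * - (P ∧ X))     ≈⟨ solve 3 (λ zp s px → (:- zp) :* (s :* :- px) := (s :* zp) :* px)
                                           refl (Z ∧ P) s (P ∧ X) ⟩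
    (s * (Z ∧ P)) * (P ∧ X)           ≈⟨ *-congʳ (x*y⁻¹*y≈x _ (Z ∧ P) _) ⟩
    (μ * (X ∧ Z)) * (P ∧ X)           ≈⟨ solve 3 (λ m xz px → (m :* xz) :* px := m :* (px :* xz))
                                           refl μ (X ∧ Z) (P ∧ X) ⟩
    μ * ((P ∧ X) * (X ∧ Z))           ≈⟨ *-congˡ (*-congʳ (P∧preimage μ)) ⟨
    μ * ((P ∧ preimage μ) * (X ∧ Z))  ∎
    where
    s : K
    s = preimage-scalar μ

  InDom : K → K → Set (c ⊔ ℓ)
  InDom c d = Σ (NonzeroV R (vec c d)) λ ncd →
    (¬ _≈P_ R (pt (vec c d) ncd) (pt (vec a b) nab)) ×
    (¬ _≈P_ R (pt (vec c d) ncd) (pt (vec x y) nxy))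

  P∧Q≉0 : ∀ {c d} → InDom c d → ¬ P ∧ vec c d ≈ 0#
  P∧Q≉0 (ncd , [Q]≉[P] , _) = ∧≉0-swap (≉P⇒∧≉0 ncd nab [Q]≉[P])

  X∧Q≉0 : ∀ {c d} → InDom c d → ¬ X ∧ vec c d ≈ 0#
  X∧Q≉0 (ncd , _ , [Q]≉[X]) = ∧≉0-swap (≉P⇒∧≉0 ncd nxy [Q]≉[X])

  transversal⇒InDom : ∀ {c d} → ¬ P ∧ vec c d ≈ 0# → ¬ X ∧ vec c d ≈ 0# → InDom c d
  transversal⇒InDom {c} {d} P∧Q≉0 X∧Q≉0 = Q≉0 , [Q]≉[P] , [Q]≉[X]
    where
    Q≉0 : NonzeroV R (vec c d)
    Q≉0 Q≈0 = P∧Q≉0 (trans (∧-cong ≈ᵥ.refl Q≈0) (∧-zeroʳ P))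
    [Q]≉[P] : ¬ _≈P_ R (pt (vec c d) Q≉0) (pt P nab)
    [Q]≉[P] [Q]≈[P] = ∧≉0-swap P∧Q≉0 (≈P⇒∧≈0 Q≉0 nab [Q]≈[P])
    [Q]≉[X] : ¬ _≈P_ R (pt (vec c d) Q≉0) (pt X nxy)
    [Q]≉[X] [Q]≈[X] = ∧≉0-swap X∧Q≉0 (≈P⇒∧≈0 Q≉0 nxy [Q]≈[X])

  φ-defined : (c d : K) → InDom c d → ¬ denom R a b c d x y z w ≈ 0#
  φ-defined c d p = x*y≉0 (P∧Q≉0 p) X∧Z≉0

  φ : (c d : K) → InDom c d → K
  φ c d p = numer R a b c d x y z w * inv (denom R a b c d x y z w) (φ-defined c d p)

  φ-well-defined : (c d c′ d′ : K) (p : InDom c d) (p′ : InDom c′ d′) →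
    _≈P_ R (pt (vec c d) (Σ.proj₁ p)) (pt (vec c′ d′) (Σ.proj₁ p′)) → φ c d p ≈ φ c′ d′ p′
  φ-well-defined c d c′ d′ p p′ (_ , _ , Q′≈tQ) =
    cross-multiply (φ-defined c d p) (φ-defined c′ d′ p′) (begin
    numer R a b c d x y z w * denominator (vec c′ d′)      ≈⟨ *-congʳ (numer≈numerator c d) ⟩
    numerator (vec c d) * denominator (vec c′ d′)          ≈⟨ cross-ratio-invariant Q′≈tQ ⟩
    numerator (vec c′ d′) * denominator (vec c d)          ≈⟨ *-congʳ (numer≈numerator c′ d′) ⟨
    numer R a b c′ d′ x y z w * denominator (vec c d)      ∎)

  φ-nonzero : (c d : K) (p : InDom c d) → ¬ φ c d p ≈ 0#
  φ-nonzero c d p = x≉0⇒x*y⁻¹≉0 (φ-defined c d p) (λ numer≈0 →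
    x*y≉0 P∧Z≉0 (X∧Q≉0 p) (trans (sym (numer≈numerator c d)) numer≈0))

  φ-injective : (c d c′ d′ : K) (p : InDom c d) (p′ : InDom c′ d′) →
    φ c d p ≈ φ c′ d′ p′ → _≈P_ R (pt (vec c d) (Σ.proj₁ p)) (pt (vec c′ d′) (Σ.proj₁ p′))
  φ-injective c d c′ d′ p p′ φ≈φ′ =
    proportional⇒≈P (Σ.proj₁ p) (Σ.proj₁ p′) (∧≈0⇒scalar-multiple (P∧Q≉0 p) (cross-ratio-injective (begin
      numerator (vec c d) * denominator (vec c′ d′)
        ≈⟨ *-congʳ (numer≈numerator c d) ⟨
      numer R a b c d x y z w * denominator (vec c′ d′)
        ≈⟨ uncross-multiply (φ-defined c d p) (φ-defined c′ d′ p′) φ≈φ′ ⟩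
      numer R a b c′ d′ x y z w * denominator (vec c d)
        ≈⟨ *-congʳ (numer≈numerator c′ d′) ⟩
      numerator (vec c′ d′) * denominator (vec c d)
        ∎)))

  φ-surjective : (μ : K) → ¬ μ ≈ 0# → Σ K λ c → Σ K λ d → Σ (InDom c d) λ p → φ c d p ≈ μ
  φ-surjective μ μ≉0 = V2.v₁ Q , V2.v₂ Q , p , x≈y*z⇒x*z⁻¹≈y (φ-defined _ _ p)
    (trans (numer≈numerator _ _) (numerator-preimage μ))
    where
    Q = preimage μ
    p : InDom (V2.v₁ Q) (V2.v₂ Q)
    p = transversal⇒InDom (λ P∧Q≈0 → P∧X≉0 (trans (sym (P∧preimage μ)) P∧Q≈0))
          (x*y≉0 (preimage-scalar≉0 μ≉0) (∧≉0-swap P∧X≉0) ∘ trans (sym (X∧preimage μ)))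

lemma4p6 : {c ℓ : Level} (R : CommutativeRing c ℓ) → (F : IsAlgClosedChar0Field R) →
  let open CommutativeRing R renaming (Carrier to K) in
  ((e f h : M2 R) (λ' : K) (a b c d x y z w : K) →
    IsIdempotent R e → IsRankOne R e →
    IsIdempotent R f → IsRankOne R f →
    IsIdempotent R h → IsRankOne R h →
    _≈M_ R (_*M_ R e f) (_·M_ R λ' h) →
    πIs R e (vec a b) (vec c d) →
    πIs R f (vec x y) (vec z w) →
    πIs R h (vec a b) (vec z w) →
    (¬ (denom R a b c d x y z w ≈ 0#)) × (λ' * denom R a b c d x y z w ≈ numer R a b c d x y z w))
  ×
  ((a b x y z w : K)
    (nab : NonzeroV R (vec a b)) (nxy : NonzeroV R (vec x y)) (nzw : NonzeroV R (vec z w)) →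
    ¬ _≈P_ R (pt (vec a b) nab) (pt (vec x y) nxy) →
    ¬ _≈P_ R (pt (vec a b) nab) (pt (vec z w) nzw) →
    ¬ _≈P_ R (pt (vec x y) nxy) (pt (vec z w) nzw) →
    let open IsField (IsAlgClosedChar0Field.isField F) using (inv) in
    let InDom : K → K → Set _
        InDom c d = Σ (NonzeroV R (vec c d)) λ ncd →
          (¬ _≈P_ R (pt (vec c d) ncd) (pt (vec a b) nab)) ×
          (¬ _≈P_ R (pt (vec c d) ncd) (pt (vec x y) nxy)) in
    (Σ ((c d : K) → InDom c d → ¬ (denom R a b c d x y z w ≈ 0#)) λ D≉0 →
      let φ : (c d : K) → InDom c d → K
          φ c d p = numer R a b c d x y z w * inv (denom R a b c d x y z w) (D≉0 c d p) in
      ((c d c' d' : K) (p : InDom c d) (p' : InDom c' d') →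
         _≈P_ R (pt (vec c d) (Σ.proj₁ p)) (pt (vec c' d') (Σ.proj₁ p')) → φ c d p ≈ φ c' d' p')
      × ((c d : K) (p : InDom c d) → ¬ (φ c d p ≈ 0#))
      × ((c d c' d' : K) (p : InDom c d) (p' : InDom c' d') →
         φ c d p ≈ φ c' d' p' → _≈P_ R (pt (vec c d) (Σ.proj₁ p)) (pt (vec c' d') (Σ.proj₁ p')))
      × ((μ : K) → ¬ (μ ≈ 0#) → Σ K λ c → Σ K λ d → Σ (InDom c d) λ p → φ c d p ≈ μ)))
lemma4p6 R F =
  (λ e f h λ′ a b c d x y z w e²≈e _ f²≈f _ h²≈h _ ef≈λh πe πf (imʰ , _) →
    let D≉0 , λ′D≈N = idempotent-product-coefficient e²≈e f²≈f h²≈h ef≈λh πe πf imʰ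
    in D≉0 , trans λ′D≈N (sym (numer-as-∧ a b c d x y z w))) ,
  (λ a b x y z w nab nxy nzw nPX nPZ nXZ →
    let open CrossRatio R field′ a b x y z w nab nxy nzw nPX nPZ nXZ
    in φ-defined , φ-well-defined , φ-nonzero , φ-injective , φ-surjective)
  where
  open CommutativeRing R using (sym; trans)
  field′ : IsField R
  field′ = IsAlgClosedChar0Field.isField F
  open PlaneVectors R using (numer-as-∧)
  open IdempotentProducts R field′ using (idempotent-product-coefficient)
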